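{- Let $b$ and $\ell$ be integers with $b\ge 3$, $\ell\ge 1$ and $b^\ell>4$. If $k$ is an integer with $1\le k\le b-2$, then $\mathrm{b}(kb^\ell+1,b)\le \ell+2$.
   Context: $\mathrm{b}(a,b)$ denotes the base size (smallest cardinality of a subset whose pointwise stabilizer is trivial) of $\mathrm{Sym}(ab)$ acting on the set of partitions of $\{1,\ldots,ab\}$ into $b$ parts each of cardinality $a$. -}

module Defs where

open import Data.Nat using (ℕ; _*_; _≤_)
open import Data.Fin using (Fin; _≟_)
open import Data.List using (List; length; filter)
open import Data.List.Membership.Propositional using (_∈_)
open import Data.Fin.Permutation using (Permutation′; _⟨$⟩ʳ_)
open import Data.Product using (Σ; ∃; _×_; proj₁)
open import Function.Bundles using (_⇔_)
open import Relation.Binary.PropositionalEquality using (_≡_)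
import Data.List

fiberSize : ∀ {n b} → (Fin n → Fin b) → Fin b → ℕ
fiberSize {n} f i = length (filter (λ x → f x ≟ i) (Data.List.allFin n))

-- A partition of {1,…,ab} into b parts each of size a, presented by a
-- labelling of the points by block names (Fin b) with every block of size a.
-- Two labellings describe the same (unordered) partition iff they induce
-- the same "same block" relation; all notions below depend only on that relation.
Partition : ℕ → ℕ → Set
Partition a b = Σ (Fin (a * b) → Fin b) (λ f → ∀ i → fiberSize f i ≡ a)

Fixes : ∀ {a b} → Permutation′ (a * b) → Partition a b → Set
Fixes σ P = ∀ x y → (proj₁ P x ≡ proj₁ P y) ⇔ (proj₁ P (σ ⟨$⟩ʳ x) ≡ proj₁ P (σ ⟨$⟩ʳ y))

IsBase : ∀ {a b} → List (Partition a b) → Set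
IsBase {a} {b} Ps = ∀ (σ : Permutation′ (a * b)) → (∀ P → P ∈ Ps → Fixes σ P) → ∀ x → σ ⟨$⟩ʳ x ≡ x

BaseSizeAtMost : ℕ → ℕ → ℕ → Set
BaseSizeAtMost a b m = ∃ λ (Ps : List (Partition a b)) → IsBase Ps × length Ps ≤ m

{-# OPTIONS --safe #-}
module Submission where

open import Defs
open import Data.Nat using (ℕ; zero; suc; _+_; _*_; _^_; _∸_; _≤_; _<_; _<?_; _%_; z≤n; s≤s; NonZero)
import Data.Nat as ℕ
open import Data.Nat.Properties
  using ( +-0-commutativeMonoid; +-*-semiring; +-commutativeSemigroup; +-assoc; +-comm; +-identityʳ
        ; +-cancelˡ-≡; +-monoʳ-≤; *-comm; *-identityʳ; *-zeroʳ; ≤-refl; ≤-reflexive; ≤-trans; ≤-<-trans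
        ; <-trans; <⇒≤; <⇒≢; <⇒≱; ≤-pred; m≤m+n; m≤n+m; n<1+n; n≤1+n; m+[n∸m]≡n; m∸n+n≡m; ∸-monoʳ-<
        ; m≤o∸n⇒m+n≤o )
open import Data.Nat.DivMod using (m%n<n; %-distribˡ-+; m%n%n≡m%n; [m+n]%n≡m%n; m<n⇒m%n≡m)
open import Data.Bool using (true; false; if_then_else_)
open import Data.Fin
  using (Fin; zero; suc; toℕ; fromℕ<; _↑ˡ_; _↑ʳ_; combine; splitAt; remQuot; join; finToFun; funToFin; _≟_)
open import Data.Fin.Properties
  using ( toℕ-fromℕ<; fromℕ<-injective; toℕ-injective; toℕ<n; splitAt-↑ˡ; splitAt-↑ʳ; join-splitAt
        ; remQuot-combine; combine-remQuot; finToFun-funToFin; funToFin-finToFin; pigeonhole )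
open import Data.Fin.Permutation using (Permutation′; permutation; _⟨$⟩ʳ_; _⟨$⟩ˡ_; inverseʳ)
open import Data.List using (List; _∷_; length; filter; tabulate)
open import Data.List.Properties using (length-tabulate)
open import Data.List.Membership.Propositional using (_∈_)
open import Data.List.Membership.Propositional.Properties using (∈-tabulate⁺)
open import Data.List.Relation.Unary.Any using (here; there)
open import Data.Product using (∃-syntax; _×_; _,_; proj₁; proj₂; map₁; map₂)
open import Data.Sum using (_⊎_; inj₁; inj₂; [_,_]′)
open import Data.Empty using (⊥-elim)
open import Function using (_∘_)
open import Function.Bundles using (Equivalence)
open import Relation.Nullary using (Dec; does; ¬_; yes; no)
open import Relation.Binary.PropositionalEquality
  using (_≡_; _≢_; refl; sym; trans; cong; cong₂; subst; module ≡-Reasoning)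
open import Algebra.Properties.CommutativeSemigroup +-commutativeSemigroup using (x∙yz≈y∙xz)
open import Algebra.Properties.CommutativeMonoid.Sum +-0-commutativeMonoid
  using (sum; sum-syntax; sum-cong-≗; ∑-comm; ∑-permute)
open import Algebra.Properties.Semiring.Sum +-*-semiring using (*-distribˡ-sum)

-- Write ℓ = n₀ + 1 and view the (k·b^ℓ + 1)·b points as pairs (row, column x ∈ ℤ_b): one diagonal
-- row, and k·b^ℓ generic rows (e, a, g) with e < k, a ∈ ℤ_b and g a word of n₀ base-b digits. The
-- base consists of the column partition X, the partition A by a (by x on the diagonal row), the
-- partition C by a + shift(x, e) mod b, and one partition per digit of g; here shift(x, e) lies in
-- {1, …, k+1} and equals 1 exactly when e = 0 and x is one of the s "low" columns x < s, where s = 1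
-- if ℓ ≥ 2 and s = 2 if ℓ = 1. Every block has k·b^ℓ + 1 points.
--
-- A permutation fixing every partition permutes the block labels of each, and since a point is
-- determined by its labels it permutes the label vectors (x, a, c, digits) that occur. A diagonal
-- vector (i, …, i) must go to a diagonal vector: otherwise changing a spare digit of its image, or
-- its column among two columns with the same shift, gives an occurring vector whose preimage does
-- not occur. So all label permutations coincide. The vectors with c = a + 1 are exactly those of low
-- columns; as there are more high than low columns, low columns go to low columns and the common
-- permutation commutes with a ↦ a + 1. It is thus a translation of ℤ_b keeping the low columns low,
-- hence the identity, and then so is the permutation of the points.

-- Finite sums of natural numbers

𝟙 : ∀ {p} {P : Set p} → Dec P → ℕ
𝟙 P? = if does P? then 1 else 0

∑-const : ∀ n c → ∑[ i < n ] c ≡ n * c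
∑-const zero    c = refl
∑-const (suc n) c = cong (c +_) (∑-const n c)

∑-↑ : ∀ m {n} (f : Fin (m + n) → ℕ) → sum f ≡ ∑[ i < m ] f (i ↑ˡ n) + ∑[ j < n ] f (m ↑ʳ j)
∑-↑ zero    f = refl
∑-↑ (suc m) f = trans (cong (f zero +_) (∑-↑ m (f ∘ suc))) (sym (+-assoc (f zero) _ _))

∑-combine : ∀ m {n} (f : Fin (m * n) → ℕ) → sum f ≡ ∑[ i < m ] ∑[ j < n ] f (combine i j)
∑-combine zero        f = refl
∑-combine (suc m) {n} f = trans (∑-↑ n f) (cong (∑[ j < n ] f (j ↑ˡ m * n) +_) (∑-combine m (f ∘ (n ↑ʳ_))))

∑-splitAt : ∀ m {n} (G : Fin m ⊎ Fin n → ℕ) →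
  ∑[ y < m + n ] G (splitAt m y) ≡ ∑[ i < m ] G (inj₁ i) + ∑[ j < n ] G (inj₂ j)
∑-splitAt m {n} G = trans (∑-↑ m (G ∘ splitAt m))
  (cong₂ _+_ (sum-cong-≗ (λ i → cong G (splitAt-↑ˡ m i n))) (sum-cong-≗ (λ j → cong G (splitAt-↑ʳ m n j))))

∑-remQuot : ∀ m {n} (G : Fin m × Fin n → ℕ) → ∑[ y < m * n ] G (remQuot n y) ≡ ∑[ i < m ] ∑[ j < n ] G (i , j)
∑-remQuot m {n} G = trans (∑-combine m (G ∘ remQuot n))
  (sum-cong-≗ (λ i → sum-cong-≗ (λ j → cong G (remQuot-combine i j))))

length-filter-tabulate : ∀ {a p} {A : Set a} {P : A → Set p} (P? : ∀ x → Dec (P x)) {n} (h : Fin n → A) →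
  length (filter P? (tabulate h)) ≡ ∑[ i < n ] 𝟙 (P? (h i))
length-filter-tabulate P? {zero}  h = refl
length-filter-tabulate P? {suc n} h with does (P? (h zero))
... | true  = cong suc (length-filter-tabulate P? (h ∘ suc))
... | false = length-filter-tabulate P? (h ∘ suc)

∑-𝟙-≟ : ∀ {n} (v : Fin n) → ∑[ i < n ] 𝟙 (i ≟ v) ≡ 1
∑-𝟙-≟ {suc n} zero    = cong suc (trans (∑-const n 0) (*-zeroʳ n))
∑-𝟙-≟ {suc n} (suc v) = ∑-𝟙-≟ v

∑-𝟙-permutation : ∀ {n} (π : Permutation′ n) (v : Fin n) → ∑[ i < n ] 𝟙 (π ⟨$⟩ʳ i ≟ v) ≡ 1
∑-𝟙-permutation π v = trans (sym (∑-permute (λ j → 𝟙 (j ≟ v)) π)) (∑-𝟙-≟ v)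

-- Cyclic shifts of Fin n

module CyclicShift (n : ℕ) .{{_ : NonZero n}} where

  infixl 6 _⊕_

  _⊕_ : Fin n → ℕ → Fin n
  i ⊕ d = fromℕ< (m%n<n (toℕ i + d) n)

  toℕ-⊕ : ∀ i d → toℕ (i ⊕ d) ≡ (toℕ i + d) % n
  toℕ-⊕ i d = toℕ-fromℕ< (m%n<n (toℕ i + d) n)

  toℕ-⊕-< : ∀ i d → toℕ i + d < n → toℕ (i ⊕ d) ≡ toℕ i + d
  toℕ-⊕-< i d i+d<n = trans (toℕ-⊕ i d) (m<n⇒m%n≡m i+d<n)

  ⊕-assoc : ∀ i d e → i ⊕ d ⊕ e ≡ i ⊕ (d + e)
  ⊕-assoc i d e = toℕ-injective (begin
    toℕ (i ⊕ d ⊕ e)                     ≡⟨ toℕ-⊕ (i ⊕ d) e ⟩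
    (toℕ (i ⊕ d) + e) % n               ≡⟨ cong (λ j → (j + e) % n) (toℕ-⊕ i d) ⟩
    ((toℕ i + d) % n + e) % n           ≡⟨ %-distribˡ-+ ((toℕ i + d) % n) e n ⟩
    ((toℕ i + d) % n % n + e % n) % n   ≡⟨ cong (λ j → (j + e % n) % n) (m%n%n≡m%n (toℕ i + d) n) ⟩
    ((toℕ i + d) % n + e % n) % n       ≡⟨ %-distribˡ-+ (toℕ i + d) e n ⟨
    (toℕ i + d + e) % n                 ≡⟨ cong (_% n) (+-assoc (toℕ i) d e) ⟩
    (toℕ i + (d + e)) % n               ≡⟨ toℕ-⊕ i (d + e) ⟨
    toℕ (i ⊕ (d + e))                   ∎)
    where open ≡-Reasoning

  ⊕-identityʳ : ∀ i → i ⊕ 0 ≡ i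
  ⊕-identityʳ i = toℕ-injective (trans (toℕ-⊕ i 0)
    (trans (cong (_% n) (+-identityʳ (toℕ i))) (m<n⇒m%n≡m (toℕ<n i))))

  ⊕-period : ∀ i → i ⊕ n ≡ i
  ⊕-period i = toℕ-injective (trans (toℕ-⊕ i n) (trans ([m+n]%n≡m%n (toℕ i) n) (m<n⇒m%n≡m (toℕ<n i))))

  ⊕-∸-inverse : ∀ i {d} → d ≤ n → i ⊕ d ⊕ (n ∸ d) ≡ i
  ⊕-∸-inverse i {d} d≤n = trans (⊕-assoc i d (n ∸ d)) (trans (cong (i ⊕_) (m+[n∸m]≡n d≤n)) (⊕-period i))

  ∸-⊕-inverse : ∀ i {d} → d ≤ n → i ⊕ (n ∸ d) ⊕ d ≡ i
  ∸-⊕-inverse i {d} d≤n = trans (⊕-assoc i (n ∸ d) d) (trans (cong (i ⊕_) (m∸n+n≡m d≤n)) (⊕-period i))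

  ⊕-permutation : ∀ {d} → d ≤ n → Permutation′ n
  ⊕-permutation {d} d≤n = permutation (_⊕ d) (_⊕ (n ∸ d)) (λ j → ∸-⊕-inverse j d≤n) (λ i → ⊕-∸-inverse i d≤n)

  ⊕-cancelˡ : ∀ i {d e} → d < n → e < n → i ⊕ d ≡ i ⊕ e → d ≡ e
  ⊕-cancelˡ i {d} {e} d<n e<n eq =
    trans (unshift d<n) (trans (cong (λ j → toℕ (j ⊕ (n ∸ toℕ i))) eq) (sym (unshift e<n)))
    where
    unshift : ∀ {d} → d < n → d ≡ toℕ (i ⊕ d ⊕ (n ∸ toℕ i))
    unshift {d} d<n = sym (begin
      toℕ (i ⊕ d ⊕ (n ∸ toℕ i))         ≡⟨ cong toℕ (⊕-assoc i d (n ∸ toℕ i)) ⟩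
      toℕ (i ⊕ (d + (n ∸ toℕ i)))       ≡⟨ toℕ-⊕ i (d + (n ∸ toℕ i)) ⟩
      (toℕ i + (d + (n ∸ toℕ i))) % n   ≡⟨ cong (_% n) (x∙yz≈y∙xz (toℕ i) d (n ∸ toℕ i)) ⟩
      (d + (toℕ i + (n ∸ toℕ i))) % n   ≡⟨ cong (λ j → (d + j) % n) (m+[n∸m]≡n (<⇒≤ (toℕ<n i))) ⟩
      (d + n) % n                       ≡⟨ [m+n]%n≡m%n d n ⟩
      d % n                             ≡⟨ m<n⇒m%n≡m d<n ⟩
      d                                 ∎)
      where open ≡-Reasoning

  ⊕-fixedPointFree : ∀ i {d} → 0 < d → d < n → i ⊕ d ≢ i
  ⊕-fixedPointFree i 0<d d<n eq =
    <⇒≢ 0<d (sym (⊕-cancelˡ i d<n (≤-<-trans z≤n d<n) (trans eq (sym (⊕-identityʳ i)))))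

-- Base-b digits

digit-count : ∀ b {n} (t : Fin n) (v : Fin b) → b * ∑[ g < b ^ n ] 𝟙 (finToFun g t ≟ v) ≡ b ^ n
digit-count b {suc n} zero v = cong (b *_) (begin
  ∑[ g < b ^ suc n ] 𝟙 (finToFun {n = suc n} g zero ≟ v)  ≡⟨ ∑-remQuot b {b ^ n} (λ (h , _) → 𝟙 (h ≟ v)) ⟩
  ∑[ h < b ] ∑[ r < b ^ n ] 𝟙 (h ≟ v)                     ≡⟨ ∑-comm {b} {b ^ n} (λ h _ → 𝟙 (h ≟ v)) ⟩
  ∑[ r < b ^ n ] ∑[ h < b ] 𝟙 (h ≟ v)                     ≡⟨ sum-cong-≗ {b ^ n} (λ _ → ∑-𝟙-≟ v) ⟩
  ∑[ r < b ^ n ] 1                                        ≡⟨ ∑-const (b ^ n) 1 ⟩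
  b ^ n * 1                                               ≡⟨ *-identityʳ (b ^ n) ⟩
  b ^ n                                                   ∎)
  where open ≡-Reasoning
digit-count b {suc n} (suc t) v = cong (b *_) (begin
  ∑[ g < b ^ suc n ] 𝟙 (finToFun {n = suc n} g (suc t) ≟ v)
    ≡⟨ ∑-remQuot b {b ^ n} (λ (_ , r) → 𝟙 (finToFun r t ≟ v)) ⟩
  ∑[ h < b ] ∑[ r < b ^ n ] 𝟙 (finToFun r t ≟ v)          ≡⟨ ∑-const b _ ⟩
  b * ∑[ r < b ^ n ] 𝟙 (finToFun r t ≟ v)                 ≡⟨ digit-count b t v ⟩
  b ^ n                                                   ∎)
  where open ≡-Reasoning

funToFin-cong : ∀ {m n} {f f′ : Fin m → Fin n} → (∀ i → f i ≡ f′ i) → funToFin f ≡ funToFin f′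
funToFin-cong {zero}  eq = refl
funToFin-cong {suc m} eq = cong₂ combine (eq zero) (funToFin-cong (eq ∘ suc))

finToFun-injective : ∀ {m n} {g g′ : Fin (m ^ n)} → (∀ t → finToFun {m} {n} g t ≡ finToFun g′ t) → g ≡ g′
finToFun-injective {m} {n} {g} {g′} eq =
  trans (sym (funToFin-finToFin {n} {m} g)) (trans (funToFin-cong eq) (funToFin-finToFin {n} {m} g′))

-- Block permutations and a pigeonhole bound

module InducedPermutation {a b} (σ : Permutation′ (a * b)) (P : Partition a b) (σ-fixes-P : Fixes σ P)
  (r : Fin b → Fin (a * b)) (r-section : ∀ i → proj₁ P (r i) ≡ i) where

  private
    φ = proj₁ P

  π : Fin b → Fin b
  π i = φ (σ ⟨$⟩ʳ r i)

  φ-σ : ∀ x → φ (σ ⟨$⟩ʳ x) ≡ π (φ x)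
  φ-σ x = Equivalence.to (σ-fixes-P x (r (φ x))) (sym (r-section (φ x)))

  π-injective : ∀ {i j} → π i ≡ π j → i ≡ j
  π-injective {i} {j} eq =
    trans (sym (r-section i)) (trans (Equivalence.from (σ-fixes-P (r i) (r j)) eq) (r-section j))

  π-surjective : ∀ j → ∃[ i ] π i ≡ j
  π-surjective j = φ x , trans (sym (φ-σ x)) (trans (cong φ (inverseʳ σ)) (r-section j))
    where x = σ ⟨$⟩ˡ r j

low-cannot-cover-high : ∀ {n s} → s + s < n → (φ : Fin n → Fin n) →
  ¬ (∀ u → s ≤ toℕ u → ∃[ u′ ] φ u′ ≡ u × toℕ u′ < s)
low-cannot-cover-high {n} {s} 2s<n φ cover =
  let i , j , i<j , same-preimage = pigeonhole (n<1+n s) (λ j → fromℕ< (u′<s j))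
  in <⇒≢ i<j (+-cancelˡ-≡ s (toℕ i) (toℕ j) (begin
    s + toℕ i        ≡⟨ toℕ-fromℕ< (high< i) ⟨
    toℕ (high i)     ≡⟨ cong toℕ (φu′≡high i) ⟨
    toℕ (φ (u′ i))   ≡⟨ cong (toℕ ∘ φ) (toℕ-injective (fromℕ<-injective _ _ (u′<s i) (u′<s j) same-preimage)) ⟩
    toℕ (φ (u′ j))   ≡⟨ cong toℕ (φu′≡high j) ⟩
    toℕ (high j)     ≡⟨ toℕ-fromℕ< (high< j) ⟩
    s + toℕ j        ∎))
  where
  open ≡-Reasoning
  high< : (j : Fin (suc s)) → s + toℕ j < n
  high< j = ≤-<-trans (+-monoʳ-≤ s (≤-pred (toℕ<n j))) 2s<n
  high : Fin (suc s) → Fin n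
  high j = fromℕ< (high< j)
  high-≥ : ∀ j → s ≤ toℕ (high j)
  high-≥ j rewrite toℕ-fromℕ< (high< j) = m≤m+n s (toℕ j)
  u′ : Fin (suc s) → Fin n
  u′ j = proj₁ (cover (high j) (high-≥ j))
  φu′≡high : ∀ j → φ (u′ j) ≡ high j
  φu′≡high j = proj₁ (proj₂ (cover (high j) (high-≥ j)))
  u′<s : ∀ j → toℕ (u′ j) < s
  u′<s j = proj₂ (proj₂ (cover (high j) (high-≥ j)))

module Construction (b′ k′ n₀ s : ℕ) (k+2≤b : suc k′ + 2 ≤ suc b′) where

  b k L m : ℕ
  b = suc b′
  k = suc k′
  L = b ^ n₀
  m = k * (b * L)

  open CyclicShift b

  2+k≤b : 2 + k ≤ b
  2+k≤b = subst (_≤ b) (+-comm k 2) k+2≤b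

  1<b : 1 < b
  1<b = ≤-trans (m≤n+m 2 k) k+2≤b

  shift : Fin b → Fin k → ℕ
  shift x zero with toℕ x <? s
  ... | yes _ = 1
  ... | no _  = 2
  shift x (suc e) = 3 + toℕ e

  shift-zero≤2 : ∀ x → shift x zero ≤ 2
  shift-zero≤2 x with toℕ x <? s
  ... | yes _ = s≤s z≤n
  ... | no _  = ≤-refl

  shift-zero<shift-suc : ∀ x e → shift x zero < shift x (suc e)
  shift-zero<shift-suc x e = ≤-trans (s≤s (shift-zero≤2 x)) (m≤m+n 3 (toℕ e))

  0<shift : ∀ x e → 0 < shift x e
  0<shift x zero with toℕ x <? s
  ... | yes _ = s≤s z≤n
  ... | no _  = s≤s z≤n
  0<shift x (suc e) = s≤s z≤n

  shift<b : ∀ x e → shift x e < b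
  shift<b x e = ≤-trans (shift<2+k e) 2+k≤b
    where
    shift<2+k : ∀ e → shift x e < 2 + k
    shift<2+k zero    = ≤-trans (s≤s (shift-zero≤2 x)) (s≤s (s≤s (s≤s z≤n)))
    shift<2+k (suc e) = s≤s (s≤s (s≤s (toℕ<n e)))

  shift-low : ∀ {x} → toℕ x < s → shift x zero ≡ 1
  shift-low {x} x<s with toℕ x <? s
  ... | yes _   = refl
  ... | no  x≮s = ⊥-elim (x≮s x<s)

  shift≡1 : ∀ x e → shift x e ≡ 1 → e ≡ zero × toℕ x < s
  shift≡1 x zero eq with toℕ x <? s
  ... | yes x<s = refl , x<s
  shift≡1 x zero () | no _
  shift≡1 x (suc e) ()

  shift-high : ∀ x e {u} → shift x e ≢ 1 → s ≤ toℕ u → shift u e ≡ shift x e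
  shift-high x zero {u} ≢1 s≤u with toℕ x <? s | toℕ u <? s
  ... | yes _ | _       = ⊥-elim (≢1 refl)
  ... | no _  | yes u<s = ⊥-elim (<⇒≱ u<s s≤u)
  ... | no _  | no _    = refl
  shift-high x (suc e) _ _ = refl

  shift-injective : ∀ {x e e′} → shift x e ≡ shift x e′ → e ≡ e′
  shift-injective {x} {zero}  {zero}   _  = refl
  shift-injective {x} {zero}  {suc e′} eq = ⊥-elim (<⇒≢ (shift-zero<shift-suc x e′) eq)
  shift-injective {x} {suc e} {zero}   eq = ⊥-elim (<⇒≢ (shift-zero<shift-suc x e) (sym eq))
  shift-injective {x} {suc e} {suc e′} eq = cong suc (toℕ-injective (cong (_∸ 3) eq))

  data Row : Set where
    generic  : (e : Fin k) (a : Fin b) (g : Fin L) → Row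
    diagonal : Row

  Point : Set
  Point = Row × Fin b

  genericRow : Fin k × Fin b × Fin L → Row
  genericRow (e , a , g) = generic e a g

  toRow : Fin (m + 1) → Row
  toRow q = [ genericRow ∘ map₂ (remQuot L) ∘ remQuot (b * L) , (λ _ → diagonal) ]′ (splitAt m q)

  fromRow : Row → Fin (m + 1)
  fromRow (generic e a g) = combine e (combine a g) ↑ˡ 1
  fromRow diagonal        = m ↑ʳ zero

  toRow-fromRow : ∀ r → toRow (fromRow r) ≡ r
  toRow-fromRow (generic e a g) = begin
    toRow (combine e (combine a g) ↑ˡ 1)
      ≡⟨ cong [ _ , _ ]′ (splitAt-↑ˡ m (combine e (combine a g)) 1) ⟩
    genericRow (map₂ (remQuot L) (remQuot (b * L) (combine e (combine a g))))
      ≡⟨ cong (genericRow ∘ map₂ (remQuot L)) (remQuot-combine e (combine a g)) ⟩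
    genericRow (e , remQuot L (combine a g))
      ≡⟨ cong (genericRow ∘ (e ,_)) (remQuot-combine a g) ⟩
    generic e a g ∎
    where open ≡-Reasoning
  toRow-fromRow diagonal = cong [ _ , _ ]′ (splitAt-↑ʳ m 1 zero)

  fromRow-toRow : ∀ q → fromRow (toRow q) ≡ q
  fromRow-toRow q with splitAt m q in eq
  ... | inj₁ r = begin
    combine e (combine a g) ↑ˡ 1   ≡⟨ cong (λ r′ → combine e r′ ↑ˡ 1) (combine-remQuot {b} L r′) ⟩
    combine e r′ ↑ˡ 1              ≡⟨ cong (_↑ˡ 1) (combine-remQuot {k} (b * L) r) ⟩
    join m 1 (inj₁ r)              ≡⟨ cong (join m 1) eq ⟨
    join m 1 (splitAt m q)         ≡⟨ join-splitAt m 1 q ⟩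
    q                              ∎
    where
    open ≡-Reasoning
    e = proj₁ (remQuot {k} (b * L) r)
    r′ = proj₂ (remQuot {k} (b * L) r)
    a = proj₁ (remQuot {b} L r′)
    g = proj₂ (remQuot {b} L r′)
  ... | inj₂ zero = trans (cong (join m 1) (sym eq)) (join-splitAt m 1 q)

  toPoint : Fin ((m + 1) * b) → Point
  toPoint y = map₁ toRow (remQuot b y)

  fromPoint : Point → Fin ((m + 1) * b)
  fromPoint (r , x) = combine (fromRow r) x

  toPoint-fromPoint : ∀ p → toPoint (fromPoint p) ≡ p
  toPoint-fromPoint (r , x) =
    trans (cong (map₁ toRow) (remQuot-combine (fromRow r) x)) (cong (_, x) (toRow-fromRow r))

  fromPoint-toPoint : ∀ y → fromPoint (toPoint y) ≡ y
  fromPoint-toPoint y =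
    trans (cong (λ q → combine q (proj₂ (remQuot {m + 1} b y))) (fromRow-toRow _)) (combine-remQuot {m + 1} b y)

  toPoint-injective : ∀ {y y′} → toPoint y ≡ toPoint y′ → y ≡ y′
  toPoint-injective {y} {y′} eq =
    trans (sym (fromPoint-toPoint y)) (trans (cong fromPoint eq) (fromPoint-toPoint y′))

  ∑-toPoint : ∀ (G : Point → ℕ) → ∑[ y < (m + 1) * b ] G (toPoint y) ≡
    ∑[ e < k ] ∑[ a < b ] ∑[ g < L ] ∑[ x < b ] G (generic e a g , x) + ∑[ x < b ] G (diagonal , x)
  ∑-toPoint G = begin
    ∑[ y < (m + 1) * b ] G (toPoint y)
      ≡⟨ ∑-remQuot (m + 1) (G ∘ map₁ toRow) ⟩
    ∑[ q < m + 1 ] H (toRow q)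
      ≡⟨ ∑-splitAt m (H ∘ [ _ , _ ]′) ⟩
    ∑[ r < m ] H (genericRow (map₂ (remQuot L) (remQuot (b * L) r))) + (H diagonal + 0)
      ≡⟨ cong₂ _+_ (∑-remQuot k (λ (e , r′) → H (genericRow (e , remQuot L r′)))) (+-identityʳ (H diagonal)) ⟩
    ∑[ e < k ] ∑[ r′ < b * L ] H (genericRow (e , remQuot L r′)) + H diagonal
      ≡⟨ cong (_+ H diagonal) (sum-cong-≗ (λ e → ∑-remQuot b (λ (a , g) → H (generic e a g)))) ⟩
    ∑[ e < k ] ∑[ a < b ] ∑[ g < L ] H (generic e a g) + H diagonal ∎
    where
    open ≡-Reasoning
    H : Row → ℕ
    H r = ∑[ x < b ] G (r , x)

  labelX labelA labelC : Point → Fin b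
  labelX (_ , x) = x

  labelA (generic e a g , x) = a
  labelA (diagonal , x)      = x

  labelC (generic e a g , x) = a ⊕ shift x e
  labelC (diagonal , x)      = x

  labelD : Fin n₀ → Point → Fin b
  labelD t (generic e a g , x) = finToFun g t
  labelD t (diagonal , x)      = x

  fiberSize-toPoint : ∀ (F : Point → Fin b) v →
    (∀ e → ∑[ a < b ] ∑[ g < L ] ∑[ x < b ] 𝟙 (F (generic e a g , x) ≟ v) ≡ b * L) →
    ∑[ x < b ] 𝟙 (F (diagonal , x) ≟ v) ≡ 1 →
    fiberSize (F ∘ toPoint) v ≡ m + 1
  fiberSize-toPoint F v generic-count diagonal-count = begin
    fiberSize (F ∘ toPoint) v
      ≡⟨ length-filter-tabulate (λ y → F (toPoint y) ≟ v) (λ y → y) ⟩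
    ∑[ y < (m + 1) * b ] 𝟙 (F (toPoint y) ≟ v)
      ≡⟨ ∑-toPoint (λ p → 𝟙 (F p ≟ v)) ⟩
    ∑[ e < k ] ∑[ a < b ] ∑[ g < L ] ∑[ x < b ] 𝟙 (F (generic e a g , x) ≟ v)
      + ∑[ x < b ] 𝟙 (F (diagonal , x) ≟ v)
      ≡⟨ cong₂ _+_ (trans (sum-cong-≗ generic-count) (∑-const k (b * L))) diagonal-count ⟩
    m + 1 ∎
    where open ≡-Reasoning

  ∑-transversal : ∀ (h : Fin b → Fin L → Fin b → ℕ) → (∀ g x → ∑[ a < b ] h a g x ≡ 1) →
    ∑[ a < b ] ∑[ g < L ] ∑[ x < b ] h a g x ≡ b * L
  ∑-transversal h one = begin
    ∑[ a < b ] ∑[ g < L ] ∑[ x < b ] h a g x   ≡⟨ ∑-comm (λ a g → ∑[ x < b ] h a g x) ⟩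
    ∑[ g < L ] ∑[ a < b ] ∑[ x < b ] h a g x   ≡⟨ sum-cong-≗ (λ g → ∑-comm (λ a x → h a g x)) ⟩
    ∑[ g < L ] ∑[ x < b ] ∑[ a < b ] h a g x   ≡⟨ sum-cong-≗ (λ g → trans (sum-cong-≗ (one g)) (∑-const b 1)) ⟩
    ∑[ g < L ] (b * 1)                         ≡⟨ ∑-const L (b * 1) ⟩
    L * (b * 1)                                ≡⟨ trans (cong (L *_) (*-identityʳ b)) (*-comm L b) ⟩
    b * L                                      ∎
    where open ≡-Reasoning

  fiberSize-X : ∀ v → fiberSize (labelX ∘ toPoint) v ≡ m + 1
  fiberSize-X v = fiberSize-toPoint labelX v (λ e → begin
    ∑[ a < b ] ∑[ g < L ] ∑[ x < b ] 𝟙 (x ≟ v)   ≡⟨ sum-cong-≗ {b} (λ _ → sum-cong-≗ {L} (λ _ → ∑-𝟙-≟ v)) ⟩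
    ∑[ a < b ] ∑[ g < L ] 1                      ≡⟨ sum-cong-≗ {b} (λ _ → ∑-const L 1) ⟩
    ∑[ a < b ] (L * 1)                           ≡⟨ ∑-const b (L * 1) ⟩
    b * (L * 1)                                  ≡⟨ cong (b *_) (*-identityʳ L) ⟩
    b * L                                        ∎) (∑-𝟙-≟ v)
    where open ≡-Reasoning

  fiberSize-A : ∀ v → fiberSize (labelA ∘ toPoint) v ≡ m + 1
  fiberSize-A v = fiberSize-toPoint labelA v
    (λ e → ∑-transversal (λ a _ _ → 𝟙 (a ≟ v)) (λ _ _ → ∑-𝟙-≟ v)) (∑-𝟙-≟ v)

  fiberSize-C : ∀ v → fiberSize (labelC ∘ toPoint) v ≡ m + 1
  fiberSize-C v = fiberSize-toPoint labelC v
    (λ e → ∑-transversal (λ a _ x → 𝟙 (a ⊕ shift x e ≟ v))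
                         (λ _ x → ∑-𝟙-permutation (⊕-permutation (<⇒≤ (shift<b x e))) v))
    (∑-𝟙-≟ v)

  fiberSize-D : ∀ t v → fiberSize (labelD t ∘ toPoint) v ≡ m + 1
  fiberSize-D t v = fiberSize-toPoint (labelD t) v (λ e → begin
    ∑[ a < b ] ∑[ g < L ] ∑[ x < b ] 𝟙 (finToFun g t ≟ v)
      ≡⟨ sum-cong-≗ {b} (λ _ → sum-cong-≗ {L} (λ g → ∑-const b (𝟙 (finToFun g t ≟ v)))) ⟩
    ∑[ a < b ] ∑[ g < L ] (b * 𝟙 (finToFun g t ≟ v))
      ≡⟨ sum-cong-≗ {b} (λ _ → *-distribˡ-sum b (λ g → 𝟙 (finToFun g t ≟ v))) ⟨
    ∑[ a < b ] (b * ∑[ g < L ] 𝟙 (finToFun g t ≟ v))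
      ≡⟨ ∑-const b (b * ∑[ g < L ] 𝟙 (finToFun g t ≟ v)) ⟩
    b * (b * ∑[ g < L ] 𝟙 (finToFun g t ≟ v))
      ≡⟨ cong (b *_) (digit-count b t v) ⟩
    b * L ∎) (∑-𝟙-≟ v)
    where open ≡-Reasoning

  partitionX partitionA partitionC : Partition (m + 1) b
  partitionX = labelX ∘ toPoint , fiberSize-X
  partitionA = labelA ∘ toPoint , fiberSize-A
  partitionC = labelC ∘ toPoint , fiberSize-C

  partitionD : Fin n₀ → Partition (m + 1) b
  partitionD t = labelD t ∘ toPoint , fiberSize-D t

  partitions : List (Partition (m + 1) b)
  partitions = partitionX ∷ partitionA ∷ partitionC ∷ tabulate partitionD

  length-partitions : length partitions ≡ suc n₀ + 2
  length-partitions = trans (cong (3 +_) (length-tabulate partitionD)) (cong suc (+-comm 2 n₀))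

  Occurs : Fin b → Fin b → Fin b → (Fin n₀ → Fin b) → Set
  Occurs x a c f = (x ≡ a × c ≡ a × ∀ t → f t ≡ a) ⊎ ∃[ e ] c ≡ a ⊕ shift x e

  HasLabels : Point → Fin b → Fin b → Fin b → (Fin n₀ → Fin b) → Set
  HasLabels p x a c f = labelX p ≡ x × labelA p ≡ a × labelC p ≡ c × ∀ t → labelD t p ≡ f t

  own-labels : ∀ p → HasLabels p (labelX p) (labelA p) (labelC p) (λ t → labelD t p)
  own-labels p = refl , refl , refl , λ _ → refl

  HasLabels⇒Occurs : ∀ {p x a c f} → HasLabels p x a c f → Occurs x a c f
  HasLabels⇒Occurs {generic e a g , x} (refl , refl , refl , _)  = inj₂ (e , refl)
  HasLabels⇒Occurs {diagonal , x}      (refl , refl , refl , f≡) = inj₁ (refl , refl , λ t → sym (f≡ t))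

  Occurs⇒HasLabels : ∀ {x a c f} → Occurs x a c f → ∃[ p ] HasLabels p x a c f
  Occurs⇒HasLabels {x} (inj₁ (refl , refl , f≡)) = (diagonal , x) , refl , refl , refl , λ t → sym (f≡ t)
  Occurs⇒HasLabels {x} {a} {f = f} (inj₂ (e , refl)) =
    (generic e a (funToFin f) , x) , refl , refl , refl , finToFun-funToFin f

  labels-injective : ∀ {p q} → labelX p ≡ labelX q → labelA p ≡ labelA q → labelC p ≡ labelC q →
    (∀ t → labelD t p ≡ labelD t q) → p ≡ q
  labels-injective {generic e a g , x} {generic e′ .a g′ , .x} refl refl c≡ d≡
    with shift-injective {x} {e} {e′} (⊕-cancelˡ a (shift<b x e) (shift<b x e′) c≡)
       | finToFun-injective {b} {n₀} {g} {g′} d≡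
  ... | refl | refl = refl
  labels-injective {generic e a g , x} {diagonal , .x} refl refl c≡ _ =
    ⊥-elim (⊕-fixedPointFree a (0<shift x e) (shift<b x e) c≡)
  labels-injective {diagonal , x} {generic e a g , .x} refl refl c≡ _ =
    ⊥-elim (⊕-fixedPointFree a (0<shift x e) (shift<b x e) (sym c≡))
  labels-injective {diagonal , x} {diagonal , .x} refl _ _ _ = refl

  HasLabels-unique : ∀ {p q x a c f} → HasLabels p x a c f → HasLabels q x a c f → p ≡ q
  HasLabels-unique (x≡ , a≡ , c≡ , f≡) (x≡′ , a≡′ , c≡′ , f≡′) =
    labels-injective (trans x≡ (sym x≡′)) (trans a≡ (sym a≡′)) (trans c≡ (sym c≡′))
                     (λ t → trans (f≡ t) (sym (f≡′ t)))

  Occurs-diagonal : ∀ {x a f} → Occurs x a a f → x ≡ a × ∀ t → f t ≡ a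
  Occurs-diagonal (inj₁ (x≡a , _ , f≡a)) = x≡a , f≡a
  Occurs-diagonal {x} {a} (inj₂ (e , a≡)) = ⊥-elim (⊕-fixedPointFree a (0<shift x e) (shift<b x e) (sym a≡))

  Occurs-step : ∀ {x a f} → toℕ x < s → Occurs x a (a ⊕ 1) f
  Occurs-step {a = a} x<s = inj₂ (zero , cong (a ⊕_) (sym (shift-low x<s)))

  Occurs-step⁻¹ : ∀ {x a f} → Occurs x a (a ⊕ 1) f → toℕ x < s
  Occurs-step⁻¹ {a = a} (inj₁ (_ , a⊕1≡a , _)) = ⊥-elim (⊕-fixedPointFree a (s≤s z≤n) 1<b a⊕1≡a)
  Occurs-step⁻¹ {x} {a} (inj₂ (e , eq)) = proj₂ (shift≡1 x e (sym (⊕-cancelˡ a 1<b (shift<b x e) eq)))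

  zero⊕toℕ : ∀ a → zero ⊕ toℕ a ≡ a
  zero⊕toℕ a = toℕ-injective (toℕ-⊕-< zero (toℕ a) (toℕ<n a))

  module Rigidity (0<s : 0 < s) (2s<b : s + s < b) (spare : Fin n₀ ⊎ 2 ≤ s) where

    s<b : s < b
    s<b = ≤-<-trans (m≤m+n s s) 2s<b

    twin-columns : 2 ≤ s → ∀ x e → ∃[ u ] ∃[ w ] u ≢ w × shift u e ≡ shift x e × shift w e ≡ shift x e
    twin-columns 2≤s x e with shift x e ℕ.≟ 1
    ... | no ≢1 = fromℕ< s<b , fromℕ< s+1<b , (λ eq → <⇒≢ (n<1+n s) (fromℕ<-injective _ _ s<b s+1<b eq)) ,
                  shift-high x e ≢1 (high s<b ≤-refl) , shift-high x e ≢1 (high s+1<b (n≤1+n s))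
      where
      s+1<b : suc s < b
      s+1<b = ≤-<-trans (≤-trans (≤-reflexive (+-comm 1 s)) (+-monoʳ-≤ s (≤-trans (s≤s z≤n) 2≤s))) 2s<b
      high : ∀ {n} (n<b : n < b) → s ≤ n → s ≤ toℕ (fromℕ< n<b)
      high n<b s≤n rewrite toℕ-fromℕ< n<b = s≤n
    ... | yes ≡1 with shift≡1 x e ≡1
    ...   | refl , _ = fromℕ< 0<b , fromℕ< 1<b , (λ ()) ,
                       trans (shift-low (low 0<b (≤-trans (s≤s z≤n) 2≤s))) (sym ≡1) ,
                       trans (shift-low (low 1<b 2≤s)) (sym ≡1)
      where
      0<b : 0 < b
      0<b = s≤s z≤n
      low : ∀ {n} (n<b : n < b) → n < s → toℕ (fromℕ< n<b) < s
      low n<b n<s rewrite toℕ-fromℕ< n<b = n<s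

    module LabelPermutations
      (πX πA πC : Fin b → Fin b) (πD : Fin n₀ → Fin b → Fin b)
      (πA-injective : ∀ {i j} → πA i ≡ πA j → i ≡ j)
      (πX-surjective : ∀ j → ∃[ i ] πX i ≡ j)
      (preserves : ∀ {x a c f} → Occurs x a c f → Occurs (πX x) (πA a) (πC c) (λ t → πD t (f t)))
      (reflects : ∀ {x a c f} → Occurs (πX x) (πA a) (πC c) (λ t → πD t (f t)) → Occurs x a c f)
      where

      column-determined : ∀ {i u} e → πC i ≡ πA i ⊕ shift u e → πX i ≡ u
      column-determined {i} {u} e eq with πX-surjective u
      ... | u′ , refl =
        cong πX (sym (proj₁ (Occurs-diagonal (reflects {u′} {i} {i} {λ _ → i} (inj₂ (e , eq))))))

      off-diagonal-by-digit : ∀ {i} e → Fin n₀ → πC i ≢ πA i ⊕ shift (πX i) e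
      off-diagonal-by-digit {i} e t eq = ⊕-fixedPointFree i (s≤s z≤n) 1<b
        (proj₂ (Occurs-diagonal (reflects {i} {i} {i} {λ _ → i ⊕ 1} (inj₂ (e , eq)))) t)

      off-diagonal-by-twins : ∀ {i} e → 2 ≤ s → πC i ≢ πA i ⊕ shift (πX i) e
      off-diagonal-by-twins {i} e 2≤s eq =
        let u , w , u≢w , su , sw = twin-columns 2≤s (πX i) e
        in u≢w (trans (sym (column-determined e (trans eq (cong (πA i ⊕_) (sym su)))))
                      (column-determined e (trans eq (cong (πA i ⊕_) (sym sw)))))

      π-agree : ∀ i → πX i ≡ πA i × πC i ≡ πA i × ∀ t → πD t i ≡ πA i
      π-agree i with preserves {i} {i} {i} {λ _ → i} (inj₁ (refl , refl , λ _ → refl))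
      ... | inj₁ agree    = agree
      ... | inj₂ (e , eq) = ⊥-elim ([ off-diagonal-by-digit e , off-diagonal-by-twins e ]′ spare eq)

      πC≡πA : ∀ i → πC i ≡ πA i
      πC≡πA i = proj₁ (proj₂ (π-agree i))

      step-preserved : ∀ {x} a → toℕ x < s → πC (a ⊕ 1) ≡ πA a ⊕ 1 × toℕ (πX x) < s
      step-preserved {x} a x<s with preserves {f = λ _ → a} (Occurs-step {a = a} x<s)
      ... | inj₁ (_ , πC≡ , _) =
        ⊥-elim (⊕-fixedPointFree a (s≤s z≤n) 1<b (πA-injective (trans (sym (πC≡πA (a ⊕ 1))) πC≡)))
      ... | inj₂ (e , eq) with shift (πX x) e ℕ.≟ 1
      ...   | yes ≡1 = trans eq (cong (πA a ⊕_) ≡1) , proj₂ (shift≡1 (πX x) e ≡1)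
      ...   | no ≢1  = ⊥-elim (low-cannot-cover-high 2s<b πX cover)
        where
        cover : ∀ u → s ≤ toℕ u → ∃[ u′ ] πX u′ ≡ u × toℕ u′ < s
        cover u s≤u with πX-surjective u
        ... | u′ , refl = u′ , refl , Occurs-step⁻¹ (reflects {u′} {a} {a ⊕ 1} {λ _ → a}
                (inj₂ (e , trans eq (cong (πA a ⊕_) (sym (shift-high (πX x) e ≢1 s≤u))))))

      πX-low : ∀ {x} → toℕ x < s → toℕ (πX x) < s
      πX-low = proj₂ ∘ step-preserved zero

      πA-⊕ : ∀ a n → πA (a ⊕ n) ≡ πA a ⊕ n
      πA-⊕ a zero    = trans (cong πA (⊕-identityʳ a)) (sym (⊕-identityʳ (πA a)))
      πA-⊕ a (suc n) = begin
        πA (a ⊕ suc n)   ≡⟨ cong πA (⊕-assoc a 1 n) ⟨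
        πA (a ⊕ 1 ⊕ n)   ≡⟨ πA-⊕ (a ⊕ 1) n ⟩
        πA (a ⊕ 1) ⊕ n   ≡⟨ cong (_⊕ n) (trans (sym (πC≡πA (a ⊕ 1))) (proj₁ (step-preserved a 0<s))) ⟩
        πA a ⊕ 1 ⊕ n     ≡⟨ ⊕-assoc (πA a) 1 n ⟩
        πA a ⊕ suc n     ∎
        where open ≡-Reasoning

      -- If c = toℕ (πA zero) were positive, the low column s ∸ c would be sent to column s.
      πA-zero : πA zero ≡ zero
      πA-zero with toℕ (πA zero) in c≡
      ... | zero  = toℕ-injective c≡
      ... | suc c = ⊥-elim (<⇒≱ (πX-low (subst (_< s) (sym toℕ-0⊕n) n<s)) (≤-reflexive (sym toℕ-πX-0⊕n)))
        where
        open ≡-Reasoning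
        c<s : suc c < s
        c<s = subst (_< s) c≡ (subst (λ j → toℕ j < s) (proj₁ (π-agree zero)) (πX-low 0<s))
        n = s ∸ suc c
        n<s : n < s
        n<s = ∸-monoʳ-< (s≤s z≤n) (<⇒≤ c<s)
        toℕ-0⊕n : toℕ (zero ⊕ n) ≡ n
        toℕ-0⊕n = toℕ-⊕-< zero n (<-trans n<s s<b)
        c+n≡s : toℕ (πA zero) + n ≡ s
        c+n≡s = trans (cong (_+ n) c≡) (m+[n∸m]≡n (<⇒≤ c<s))
        toℕ-πX-0⊕n : toℕ (πX (zero ⊕ n)) ≡ s
        toℕ-πX-0⊕n = begin
          toℕ (πX (zero ⊕ n))   ≡⟨ cong toℕ (proj₁ (π-agree (zero ⊕ n))) ⟩
          toℕ (πA (zero ⊕ n))   ≡⟨ cong toℕ (πA-⊕ zero n) ⟩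
          toℕ (πA zero ⊕ n)     ≡⟨ toℕ-⊕-< (πA zero) n (subst (_< b) (sym c+n≡s) s<b) ⟩
          toℕ (πA zero) + n     ≡⟨ c+n≡s ⟩
          s                     ∎

      πA-identity : ∀ i → πA i ≡ i
      πA-identity i = begin
        πA i                ≡⟨ cong πA (zero⊕toℕ i) ⟨
        πA (zero ⊕ toℕ i)   ≡⟨ πA-⊕ zero (toℕ i) ⟩
        πA zero ⊕ toℕ i     ≡⟨ cong (_⊕ toℕ i) πA-zero ⟩
        zero ⊕ toℕ i        ≡⟨ zero⊕toℕ i ⟩
        i                   ∎
        where open ≡-Reasoning

      π-identity : ∀ i → πX i ≡ i × πA i ≡ i × πC i ≡ i × ∀ t → πD t i ≡ i
      π-identity i =
        let πX≡πA , πC≡πA , πD≡πA = π-agree i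
        in trans πX≡πA (πA-identity i) , πA-identity i , trans πC≡πA (πA-identity i) ,
           λ t → trans (πD≡πA t) (πA-identity i)

    module Stabiliser (σ : Permutation′ ((m + 1) * b)) (σ-fixes : ∀ P → P ∈ partitions → Fixes σ P) where

      diagonalPoint : Fin b → Fin ((m + 1) * b)
      diagonalPoint i = fromPoint (diagonal , i)

      diagonal-label : (F : Point → Fin b) → ∀ i → F (toPoint (diagonalPoint i)) ≡ F (diagonal , i)
      diagonal-label F i = cong F (toPoint-fromPoint (diagonal , i))

      module X = InducedPermutation σ partitionX (σ-fixes _ (here refl))
                   diagonalPoint (diagonal-label labelX)
      module A = InducedPermutation σ partitionA (σ-fixes _ (there (here refl)))
                   diagonalPoint (diagonal-label labelA)
      module C = InducedPermutation σ partitionC (σ-fixes _ (there (there (here refl))))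
                   diagonalPoint (diagonal-label labelC)
      module D (t : Fin n₀) = InducedPermutation σ (partitionD t) (σ-fixes _ (there (there (there (∈-tabulate⁺ t)))))
                                diagonalPoint (diagonal-label (labelD t))

      σ-labels : ∀ {y x a c f} → HasLabels (toPoint y) x a c f →
        HasLabels (toPoint (σ ⟨$⟩ʳ y)) (X.π x) (A.π a) (C.π c) (λ t → D.π t (f t))
      σ-labels {y} (x≡ , a≡ , c≡ , f≡) =
        trans (X.φ-σ y) (cong X.π x≡) , trans (A.φ-σ y) (cong A.π a≡) , trans (C.φ-σ y) (cong C.π c≡) ,
        λ t → trans (D.φ-σ t y) (cong (D.π t) (f≡ t))

      preserves : ∀ {x a c f} → Occurs x a c f → Occurs (X.π x) (A.π a) (C.π c) (λ t → D.π t (f t))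
      preserves {x} {a} {c} {f} occurs =
        let p , p-labels = Occurs⇒HasLabels occurs
        in HasLabels⇒Occurs {toPoint (σ ⟨$⟩ʳ fromPoint p)}
             (σ-labels {fromPoint p} (subst (λ q → HasLabels q x a c f) (sym (toPoint-fromPoint p)) p-labels))

      reflects : ∀ {x a c f} → Occurs (X.π x) (A.π a) (C.π c) (λ t → D.π t (f t)) → Occurs x a c f
      reflects {x} {a} {c} {f} occurs =
        let q , qx , qa , qc , qf = Occurs⇒HasLabels occurs
            p = toPoint (σ ⟨$⟩ˡ fromPoint q)
            σp≡q : toPoint (σ ⟨$⟩ʳ (σ ⟨$⟩ˡ fromPoint q)) ≡ q
            σp≡q = trans (cong toPoint (inverseʳ σ)) (toPoint-fromPoint q)
            x′ , a′ , c′ , f′ =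
              subst (λ r → HasLabels r (X.π (labelX p)) (A.π (labelA p)) (C.π (labelC p))
                                       (λ t → D.π t (labelD t p)))
                    σp≡q (σ-labels {σ ⟨$⟩ˡ fromPoint q} (own-labels p))
        in HasLabels⇒Occurs {p} (X.π-injective (trans (sym x′) qx) , A.π-injective (trans (sym a′) qa) ,
                                 C.π-injective (trans (sym c′) qc) ,
                                 λ t → D.π-injective t (trans (sym (f′ t)) (qf t)))

      open LabelPermutations X.π A.π C.π D.π A.π-injective X.π-surjective preserves reflects

      σ-identity : ∀ y → σ ⟨$⟩ʳ y ≡ y
      σ-identity y =
        let p = toPoint y
            x′ , a′ , c′ , f′ = σ-labels {y} (own-labels p)
            πX≡id , _ = π-identity (labelX p)
            _ , πA≡id , _ = π-identity (labelA p)
            _ , _ , πC≡id , _ = π-identity (labelC p)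
            σp-labels : HasLabels (toPoint (σ ⟨$⟩ʳ y)) (labelX p) (labelA p) (labelC p) (λ t → labelD t p)
            σp-labels = trans x′ πX≡id , trans a′ πA≡id , trans c′ πC≡id ,
                        λ t → trans (f′ t) (proj₂ (proj₂ (proj₂ (π-identity (labelD t p)))) t)
        in toPoint-injective (HasLabels-unique {toPoint (σ ⟨$⟩ʳ y)} {p} σp-labels (own-labels p))

    base : BaseSizeAtMost (k * b ^ suc n₀ + 1) b (suc n₀ + 2)
    base = partitions , Stabiliser.σ-identity , ≤-reflexive length-partitions

corollary4p2 : ∀ (b ℓ k : ℕ) → 3 ≤ b → 1 ≤ ℓ → 4 < b ^ ℓ → 1 ≤ k → k ≤ b ∸ 2 →
    BaseSizeAtMost (k * b ^ ℓ + 1) b (ℓ + 2)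
corollary4p2 zero _ _ () _ _ _ _
corollary4p2 _ zero _ _ () _ _ _
corollary4p2 _ _ zero _ _ _ () _
corollary4p2 (suc b′) (suc zero) (suc k′) 3≤b _ 4<b _ k≤b∸2 =
  Construction.Rigidity.base b′ k′ 0 2 (m≤o∸n⇒m+n≤o _ (≤-trans (n≤1+n 2) 3≤b) k≤b∸2)
    (s≤s z≤n) (subst (4 <_) (*-identityʳ (suc b′)) 4<b) (inj₂ ≤-refl)
corollary4p2 (suc b′) (suc (suc n₀)) (suc k′) 3≤b _ _ _ k≤b∸2 =
  Construction.Rigidity.base b′ k′ (suc n₀) 1 (m≤o∸n⇒m+n≤o _ (≤-trans (n≤1+n 2) 3≤b) k≤b∸2)
    (s≤s z≤n) 3≤b (inj₁ zero)
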